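{- Let $E$ be an arbitrary set and $\mathscr L\subseteq\{+,-,0\}^E$ be (the set of covectors of) an oriented matroid, i.e. $\mathscr L$ satisfies (0) the all-zero sign vector lies in $\mathscr L$, (FS) and (SE). Then $\mathscr L$ is an affine oriented matroid, i.e. it also satisfies (P).
   Context: A sign vector on $E$ is a map $X:E\to\{+,-,0\}$; $-X$ is its negative, $\underline X=\{e:X(e)\neq0\}$. Separator $S(X,Y)=\{e\in\underline X\cap\underline Y:X(e)\neq Y(e)\}$; composition $(X\circ Y)(e)=X(e)$ if $X(e)\ne0$, else $Y(e)$; $(X\oplus Y)(e)=0$ if $e\in S(X,Y)$, else $(X\circ Y)(e)$. For sets of sign vectors, $\mathcal A\circ\mathcal B=\{X\circ Y\}$, $-\mathcal B=\{ -Y\}$. For $\mathscr L$: $I_e(X,Y)=\{Z\in\mathscr L:Z(e)=0,\ Z(f)=(X\circ Y)(f)\ \forall f\notin S(X,Y)\}$, $I(X,Y)=\bigcup_{e\in S(X,Y)}I_e(X,Y)$, $\mathcal P(\mathscr L)=\{X\oplus(-Y):X,Y\in\mathscr L,\ I(X,-Y)=I(-X,Y)=\emptyset\}$. Axioms: (FS) $\mathscr L\circ(-\mathscr L)\subseteq\mathscr L$; (SE) for all $X,Y\in\mathscr L$ and $e\in S(X,Y)$, $I_e(X,Y)\ne\emptyset$; (P) $\mathcal P(\mathscr L)\circ\mathscr L\subseteq\mathscr L$. An affine oriented matroid (AOM) is an $\mathscr L$ satisfying (FS), (SE), (P). -}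

module Defs where

open import Level using (Level; _⊔_; suc)
open import Data.Product using (Σ; _×_; _,_; ∃)
open import Relation.Binary.PropositionalEquality using (_≡_; _≢_)
open import Relation.Nullary using (¬_)

data Sign : Set where
  ⊕s ⊖s 0s : Sign

SignVec : ∀ {a} → Set a → Set a
SignVec E = E → Sign

SVSet : ∀ {a} (ℓ : Level) → Set a → Set (a ⊔ suc ℓ)
SVSet ℓ E = SignVec E → Set ℓ

module _ {a} {E : Set a} where

  neg : Sign → Sign
  neg ⊕s = ⊖s
  neg ⊖s = ⊕s
  neg 0s = 0s

  -_ : SignVec E → SignVec E
  (- X) e = neg (X e)

  zeroVec : SignVec E
  zeroVec _ = 0s

  InSep : SignVec E → SignVec E → E → Set
  InSep X Y e = (X e ≢ 0s) × (Y e ≢ 0s) × (X e ≢ Y e)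

  _∘s_ : Sign → Sign → Sign
  0s ∘s y = y
  ⊕s ∘s y = ⊕s
  ⊖s ∘s y = ⊖s

  _∘v_ : SignVec E → SignVec E → SignVec E
  (X ∘v Y) e = X e ∘s Y e

  _⊕s'_ : Sign → Sign → Sign
  ⊕s ⊕s' ⊖s = 0s
  ⊖s ⊕s' ⊕s = 0s
  x  ⊕s' y  = x ∘s y

  _⊕v_ : SignVec E → SignVec E → SignVec E
  (X ⊕v Y) e = X e ⊕s' Y e

  _≗v_ : SignVec E → SignVec E → Set a
  X ≗v Y = ∀ e → X e ≡ Y e

  module _ {ℓ : Level} (L : SVSet ℓ E) where

    Extensional : Set (a ⊔ ℓ)
    Extensional = ∀ {X Y} → X ≗v Y → L X → L Y

    InIe : SignVec E → SignVec E → E → SignVec E → Set (a ⊔ ℓ)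
    InIe X Y e Z = L Z × (Z e ≡ 0s) × (∀ f → ¬ InSep X Y f → Z f ≡ (X ∘v Y) f)

    IEmpty : SignVec E → SignVec E → Set (a ⊔ ℓ)
    IEmpty X Y = ∀ e → InSep X Y e → ∀ Z → ¬ InIe X Y e Z

    Zero : Set ℓ
    Zero = L zeroVec

    FS : Set (a ⊔ ℓ)
    FS = ∀ X Y → L X → L Y → L (X ∘v (- Y))

    SE : Set (a ⊔ ℓ)
    SE = ∀ X Y → L X → L Y → ∀ e → InSep X Y e → Σ (SignVec E) (InIe X Y e)

    P : Set (a ⊔ ℓ)
    P = ∀ X Y W → L X → L Y → IEmpty X (- Y) → IEmpty (- X) Y → L W
          → L ((X ⊕v (- Y)) ∘v W)

    OrientedMatroid : Set (a ⊔ ℓ)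
    OrientedMatroid = Zero × FS × SE

    AffineOrientedMatroid : Set (a ⊔ ℓ)
    AffineOrientedMatroid = FS × SE × P

-- In an oriented matroid, (SE) makes I(X,-Y) = ∅ possible only when X and -Y
-- have empty separator, and then X ⊕ (-Y) is just X ∘ (-Y). Since 0 ∈ L, (FS)
-- with X = 0 gives -L ⊆ L, so L is closed under composition and
-- (X ∘ (-Y)) ∘ W lies in L.
module Submission where

open import Defs
open import Level using (Level)
open import Data.Product using (_,_)
open import Data.Empty using (⊥-elim)
open import Relation.Nullary using (¬_)
open import Relation.Binary.PropositionalEquality using (refl)

module _ {a : Level} {E : Set a} where

  neg-involutive : (X : SignVec E) → (- (- X)) ≗v X
  neg-involutive X e with X e
  ... | ⊕s = refl
  ... | ⊖s = refl
  ... | 0s = refl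

  ⊕v≗∘v : {X Y : SignVec E} → (∀ e → ¬ InSep X Y e) → (X ⊕v Y) ≗v (X ∘v Y)
  ⊕v≗∘v {X} {Y} noSep e with X e | Y e | noSep e
  ... | ⊕s | ⊖s | conflict = ⊥-elim (conflict ((λ ()) , (λ ()) , (λ ())))
  ... | ⊖s | ⊕s | conflict = ⊥-elim (conflict ((λ ()) , (λ ()) , (λ ())))
  ... | ⊕s | ⊕s | _ = refl
  ... | ⊕s | 0s | _ = refl
  ... | ⊖s | ⊖s | _ = refl
  ... | ⊖s | 0s | _ = refl
  ... | 0s | _  | _ = refl

  module _ {ℓ : Level} {L : SVSet ℓ E} where

    FS⇒neg-closed : Zero L → FS L → ∀ X → L X → L (- X)
    FS⇒neg-closed zero fs X LX = fs zeroVec X zero LX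

    FS⇒∘-closed : Extensional L → Zero L → FS L → ∀ X Y → L X → L Y → L (X ∘v Y)
    FS⇒∘-closed ext zero fs X Y LX LY =
      ext X∘--Y≗X∘Y (fs X (- Y) LX (FS⇒neg-closed zero fs Y LY))
      where
        X∘--Y≗X∘Y : (X ∘v (- (- Y))) ≗v (X ∘v Y)
        X∘--Y≗X∘Y e rewrite neg-involutive Y e = refl

    SE⇒IEmpty⇒sep-empty : SE L → ∀ {X Y} → L X → L Y → IEmpty L X Y → ∀ e → ¬ InSep X Y e
    SE⇒IEmpty⇒sep-empty se {X} {Y} LX LY noI e sep with se X Y LX LY e sep
    ... | Z , Z∈Ie = noI e sep Z Z∈Ie

    OrientedMatroid⇒P : Extensional L → OrientedMatroid L → P L
    OrientedMatroid⇒P ext (zero , fs , se) X Y W LX LY noI _ LW =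
      ext ∘≗⊕ (∘-closed (X ∘v (- Y)) W X∘-Y∈L LW)
      where
        ∘-closed : ∀ U V → L U → L V → L (U ∘v V)
        ∘-closed = FS⇒∘-closed ext zero fs
        -Y∈L : L (- Y)
        -Y∈L = FS⇒neg-closed zero fs Y LY
        X∘-Y∈L : L (X ∘v (- Y))
        X∘-Y∈L = ∘-closed X (- Y) LX -Y∈L
        sep-empty : ∀ e → ¬ InSep X (- Y) e
        sep-empty = SE⇒IEmpty⇒sep-empty se LX -Y∈L noI
        ∘≗⊕ : ((X ∘v (- Y)) ∘v W) ≗v ((X ⊕v (- Y)) ∘v W)
        ∘≗⊕ e rewrite ⊕v≗∘v sep-empty e = refl

corollary2p6 : ∀ {a ℓ : Level} {E : Set a} (L : SVSet ℓ E)
    → Extensional L → OrientedMatroid L → AffineOrientedMatroid L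
corollary2p6 L ext om@(_ , fs , se) = fs , se , OrientedMatroid⇒P ext om
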